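{- Let $f:\mathbb{N}\to\mathbb{N}$ be an increasing function with $f(0)>0$. For every type $\tau$, every integer $r\ge 1$ and every $t\in\mathbb{N}$, \[ L_{r,\tau}(t)=L_{r\times\tau}(t). \]
   Context: A type is a finite multiset $\tau$ of natural numbers; $\mathbb{N}^\tau$ is the disjoint union of the $\mathbb{N}^{k}$ for $k\in\tau$ (with multiplicity), ordered by: $x\le y$ iff $x,y$ lie in the same summand and $x\le y$ coordinatewise. $r\times\tau$ is the multiset where each multiplicity of $\tau$ is multiplied by $r$. $\|x\|_\infty$ is the maximum coordinate of $x$ (0 for the empty tuple). A sequence $x_0,\dots,x_l$ is $t$-controlled if $\|x_i\|_\infty<f(i+t)$ for all $i$. A sequence is $r$-good if it contains indices $i_1<i_2<\dots<i_{r+1}$ with $x_{i_1}\le x_{i_2}\le\cdots\le x_{i_{r+1}}$, and $r$-bad otherwise; bad means $1$-bad. $L_\tau(t)$ is the maximal length of a $t$-controlled bad sequence over $\mathbb{N}^\tau$, and $L_{r,\tau}(t)$ the maximal length of a $t$-controlled $r$-bad sequence over $\mathbb{N}^\tau$. -}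

module Defs where

open import Data.Nat using (ℕ; zero; suc; _+_; _≤_; _<_; _⊔_)
open import Data.Fin using (Fin; toℕ; inject₁)
open import Data.List using (List; length; lookup; concatMap; replicate)
open import Data.Vec using (Vec; foldr)
open import Data.Vec.Relation.Binary.Pointwise.Inductive using (Pointwise)
open import Data.Product using (Σ; _,_; _×_)
open import Relation.Nullary using (¬_)
open import Function.Bundles using (_⇔_)

-- A type τ is a finite multiset of naturals, represented as a list
-- (order irrelevant, repetitions = multiplicities).
Ty : Set
Ty = List ℕ

-- Elements of ℕ^τ: a summand index together with a tuple in ℕ^k.
Elem : Ty → Set
Elem τ = Σ (Fin (length τ)) (λ i → Vec ℕ (lookup τ i))

data _≼_ {τ : Ty} : Elem τ → Elem τ → Set where
  same : ∀ {i} {u v : Vec ℕ (lookup τ i)} → Pointwise _≤_ u v → (i , u) ≼ (i , v)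

_×ᵀ_ : ℕ → Ty → Ty
r ×ᵀ τ = concatMap (λ k → replicate r k) τ

norm : ∀ τ → Elem τ → ℕ
norm _ (_ , v) = foldr (λ _ → ℕ) _⊔_ 0 v

Seq : Ty → ℕ → Set
Seq τ n = Fin n → Elem τ

Controlled : (ℕ → ℕ) → ℕ → ∀ {τ n} → Seq τ n → Set
Controlled f t {τ} {n} x = ∀ (i : Fin n) → norm τ (x i) < f (toℕ i + t)

Good : ℕ → ∀ {τ n} → Seq τ n → Set
Good r {τ} {n} x =
  Σ (Fin (suc r) → Fin n) λ g →
    ∀ (a : Fin r) → (toℕ (g (inject₁ a)) < toℕ (g (Fin.suc a)))
                  × (_≼_ {τ} (x (g (inject₁ a))) (x (g (Fin.suc a))))

Bad : ℕ → ∀ {τ n} → Seq τ n → Set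
Bad r {τ} {n} x = ¬ Good r {τ} {n} x

HasBad : (ℕ → ℕ) → ℕ → Ty → ℕ → ℕ → Set
HasBad f r τ t n = Σ (Seq τ n) λ x → Controlled f t {τ} {n} x × Bad r {τ} {n} x

IsMax : (ℕ → Set) → ℕ → Set
IsMax P m = P m × (∀ n → P n → n ≤ m)

-- L_{r,τ}(t) = m  and  L_τ(t) = m  (L_τ = L_{1,τ}).
IsL : (ℕ → ℕ) → ℕ → Ty → ℕ → ℕ → Set
IsL f r τ t m = IsMax (HasBad f r τ t) m

Monotone : (ℕ → ℕ) → Set
Monotone f = ∀ {a b} → a ≤ b → f a ≤ f b

module Submission where

-- Colour the elements of an r-bad sequence x by their height,
-- the length of the longest increasing chain starting at them.  Heights
-- strictly decrease along increasing pairs and stay below r, so every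
-- increasing pair is bichromatic; conversely, if some r-colouring makes every
-- increasing pair bichromatic, then any chain of r+1 elements repeats a colour
-- (pigeonhole), contradicting transitivity.  Hence, over any decidable
-- preorder, x is r-bad iff it is the union of r bad subsequences.
--
-- It then shows that
-- the summands of r ×ᵀ τ are exactly the pairs (summand of τ, copy number),
-- compatibly with dimensions, so that an element of ℕ^(r×τ) is an element of
-- ℕ^τ tagged by a colour, with the same norm, and two such elements compare
-- iff they have the same colour and the underlying elements compare.  A bad
-- sequence over ℕ^(r×τ) is thus an r-coloured sequence over ℕ^τ without
-- monochromatic increasing pairs; this identifies the lengths of t-controlled
-- r-bad sequences over ℕ^τ with those of bad sequences over ℕ^(r×τ), and
-- hence their maxima.

open import Defs
open import Data.Nat using (ℕ; _≤_; _<_)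
open import Function.Bundles using (_⇔_)

open import Data.Nat using (zero; suc; _+_; _⊔_; z≤n; s≤s; z<s; s<s; _≤?_)
open import Data.Nat.Properties using (≤-trans; <-trans; <-irrefl; ≤-pred; <-≤-trans; ≰⇒>; n<1+n; m≤m⊔n; m≤n⊔m; ⊔-sel)
open import Data.Fin using (Fin; toℕ; inject₁; fromℕ<) renaming (zero to fz; suc to fs)
open import Data.Fin.Properties using (pigeonhole; fromℕ<-injective) renaming (_≟_ to _≟F_)
open import Data.Product using (Σ; _,_; _×_; proj₁; proj₂; uncurry)
import Data.Product as Product
open import Data.Sum using (_⊎_; inj₁; inj₂; [_,_]′)
import Data.Sum as Sum
open import Data.List using (List; []; _∷_; length; lookup; _++_; replicate)
open import Data.Empty using (⊥-elim)
open import Relation.Nullary using (¬_; Dec; yes; no)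
open import Relation.Unary using (Decidable)
open import Relation.Binary.PropositionalEquality using (_≡_; _≢_; refl; sym; trans; cong; cong₂; subst)
open import Function.Bundles using (mk⇔; Equivalence)
open Equivalence using (to; from)
open import Function using (id)
open import Data.Vec using (Vec; foldr)
open import Data.Vec.Relation.Binary.Pointwise.Inductive using (Pointwise)
import Data.Vec.Relation.Binary.Pointwise.Inductive as Pointwise
open import Relation.Nullary.Decidable using (map′; _×-dec_)

supSuc : ∀ {m} {P : Fin m → Set} → Decidable P → (Fin m → ℕ) → ℕ
supSuc {zero} P? c = 0
supSuc {suc m} P? c = candidate (P? fz) ⊔ supSuc (λ k → P? (fs k)) (λ k → c (fs k))
  where
  candidate : ∀ {Q : Set} → Dec Q → ℕ
  candidate (yes _) = suc (c fz)
  candidate (no _) = 0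

supSuc-upper : ∀ {m} {P : Fin m → Set} (P? : Decidable P) (c : Fin m → ℕ) →
  ∀ k → P k → c k < supSuc P? c
supSuc-upper {suc m} P? c fz p with P? fz
... | yes _ = m≤m⊔n (suc (c fz)) (supSuc (λ k → P? (fs k)) (λ k → c (fs k)))
... | no ¬p = ⊥-elim (¬p p)
supSuc-upper {suc m} P? c (fs k) p =
  <-≤-trans (supSuc-upper (λ k → P? (fs k)) (λ k → c (fs k)) k p) (m≤n⊔m _ _)

supSuc-attained : ∀ {m} {P : Fin m → Set} (P? : Decidable P) (c : Fin m → ℕ) →
  (Q : ℕ → Set) → Q 0 → (∀ k → P k → Q (suc (c k))) → Q (supSuc P? c)
supSuc-attained {zero} P? c Q q₀ q = q₀
supSuc-attained {suc m} P? c Q q₀ q with P? fz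
... | yes p =
  ⊔-closed (q fz p) (supSuc-attained (λ k → P? (fs k)) (λ k → c (fs k)) Q q₀ (λ k → q (fs k)))
  where
  ⊔-closed : ∀ {a b} → Q a → Q b → Q (a ⊔ b)
  ⊔-closed {a} {b} qa qb with ⊔-sel a b
  ... | inj₁ e = subst Q (sym e) qa
  ... | inj₂ e = subst Q (sym e) qb
... | no _ = supSuc-attained (λ k → P? (fs k)) (λ k → c (fs k)) Q q₀ (λ k → q (fs k))

module Sequences {A : Set} (_⊑_ : A → A → Set) where

  Step : ∀ {n} → (Fin n → A) → Fin n → Fin n → Set
  Step x i j = toℕ i < toℕ j × x i ⊑ x j

  -- x is r-good: it has r+1 positions forming r consecutive increasing pairs.
  -- For A = ℕ^τ this is  Good r  of Defs, definitionally.
  GoodSeq : ℕ → ∀ {n} → (Fin n → A) → Set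
  GoodSeq r {n} x = Σ (Fin (suc r) → Fin n) λ g → ∀ a → Step x (g (inject₁ a)) (g (fs a))

  BadSeq : ℕ → ∀ {n} → (Fin n → A) → Set
  BadSeq r x = ¬ GoodSeq r x

  Splitting : ℕ → ∀ {n} → (Fin n → A) → Set
  Splitting r {n} x = Σ (Fin n → Fin r) λ c → ∀ {i j} → Step x i j → c i ≢ c j

  data Chain {n} (x : Fin n → A) : ℕ → Fin n → Set where
    []  : ∀ {i} → Chain x 0 i
    _∷_ : ∀ {k i j} → Step x i j → Chain x k j → Chain x (suc k) i

  positions : ∀ {n} {x : Fin n → A} {k i} → Chain x k i → Fin (suc k) → Fin n
  positions {i = i} [] _ = i
  positions {i = i} (_ ∷ _) fz = i
  positions (_ ∷ ch) (fs a) = positions ch a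

  positions-steps : ∀ {n} {x : Fin n → A} {k i} (ch : Chain x k i) →
    ∀ a → Step x (positions ch (inject₁ a)) (positions ch (fs a))
  positions-steps (s ∷ []) fz = s
  positions-steps (s ∷ (_ ∷ _)) fz = s
  positions-steps (_ ∷ ch) (fs a) = positions-steps ch a

  chain⇒good : ∀ {n} {x : Fin n → A} {k i} → Chain x k i → GoodSeq k x
  chain⇒good ch = positions ch , positions-steps ch

  take : ∀ {n} {x : Fin n → A} {r k i} → r ≤ k → Chain x k i → Chain x r i
  take z≤n _ = []
  take (s≤s r≤k) (s ∷ ch) = s ∷ take r≤k ch

  shift : ∀ {n} {x : Fin (suc n) → A} {k j} → Chain (λ a → x (fs a)) k j → Chain x k (fs j)
  shift [] = []
  shift ((lt , le) ∷ ch) = (s<s lt , le) ∷ shift ch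

  Heights : ∀ {n} → (Fin n → A) → Set
  Heights {n} x = Σ (Fin n → ℕ) λ h → (∀ {i j} → Step x i j → h j < h i) × (∀ j → Chain x (h j) j)

  heights : (∀ a b → Dec (a ⊑ b)) → ∀ {n} (x : Fin n → A) → Heights x
  heights _⊑?_ {zero} x = (λ ()) , (λ { {()} }) , (λ ())
  heights _⊑?_ {suc n} x = h , decreasing , chains
    where
    tail : Heights (λ a → x (fs a))
    tail = heights _⊑?_ (λ a → x (fs a))

    above : Decidable (λ k → x fz ⊑ x (fs k))
    above k = x fz ⊑? x (fs k)

    h : Fin (suc n) → ℕ
    h fz = supSuc above (proj₁ tail)
    h (fs k) = proj₁ tail k

    decreasing : ∀ {i j} → Step x i j → h j < h i
    decreasing {fz} {fs j} (_ , le) = supSuc-upper above (proj₁ tail) j le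
    decreasing {fs i} {fs j} (lt , le) = proj₁ (proj₂ tail) (≤-pred lt , le)

    chains : ∀ j → Chain x (h j) j
    chains fz = supSuc-attained above (proj₁ tail) (λ m → Chain x m fz) []
      (λ k le → (z<s , le) ∷ shift (proj₂ (proj₂ tail) k))
    chains (fs k) = shift (proj₂ (proj₂ tail) k)

  -- An r-bad sequence splits into r bad subsequences: colour by height, which
  -- is below r since a chain of r steps would make x r-good.
  bad⇒splitting : (∀ a b → Dec (a ⊑ b)) → ∀ r {n} (x : Fin n → A) → BadSeq r x → Splitting r x
  bad⇒splitting _⊑?_ r {n} x bad = colour , bichromatic
    where
    H : Heights x
    H = heights _⊑?_ x

    height<r : ∀ j → proj₁ H j < r
    height<r j with r ≤? proj₁ H j
    ... | yes r≤h = ⊥-elim (bad (chain⇒good (take r≤h (proj₂ (proj₂ H) j))))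
    ... | no r≰h = ≰⇒> r≰h

    colour : Fin n → Fin r
    colour j = fromℕ< (height<r j)

    bichromatic : ∀ {i j} → Step x i j → colour i ≢ colour j
    bichromatic {i} {j} s equal =
      <-irrefl (fromℕ<-injective _ _ (height<r j) (height<r i) (sym equal)) (proj₁ (proj₂ H) s)

  good-pairs : (∀ {a b c} → a ⊑ b → b ⊑ c → a ⊑ c) →
    ∀ r {n} (x : Fin n → A) (g : Fin (suc r) → Fin n) → (∀ a → Step x (g (inject₁ a)) (g (fs a))) →
    ∀ a b → toℕ a < toℕ b → Step x (g a) (g b)
  good-pairs ⊑-trans zero x g steps fz (fs ()) _
  good-pairs ⊑-trans (suc r) x g steps fz (fs fz) _ = steps fz
  good-pairs ⊑-trans (suc r) x g steps fz (fs (fs b)) _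
    with steps fz | good-pairs ⊑-trans r x (λ a → g (fs a)) (λ a → steps (fs a)) fz (fs b) z<s
  ... | (lt₁ , le₁) | (lt₂ , le₂) = <-trans lt₁ lt₂ , ⊑-trans le₁ le₂
  good-pairs ⊑-trans (suc r) x g steps (fs a) (fs b) lt =
    good-pairs ⊑-trans r x (λ a → g (fs a)) (λ a → steps (fs a)) a b (≤-pred lt)

  -- Conversely, a sequence split into r bad subsequences is r-bad: among r+1
  -- positions of a good sequence two share a colour (pigeonhole), and by
  -- transitivity they form a monochromatic increasing pair.
  splitting⇒bad : (∀ {a b c} → a ⊑ b → b ⊑ c → a ⊑ c) →
    ∀ r {n} (x : Fin n → A) → Splitting r x → BadSeq r x
  splitting⇒bad ⊑-trans r x (colour , bichromatic) (g , steps)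
    with pigeonhole (n<1+n r) (λ a → colour (g a))
  ... | p , q , p<q , equal = bichromatic (good-pairs ⊑-trans r x g steps p q p<q) equal

  bad₁ : ∀ {n} (x : Fin n → A) → (∀ {i j} → ¬ Step x i j) → BadSeq 1 x
  bad₁ x no-pair (g , steps) = no-pair (steps fz)

  bad₁-pair : ∀ {n} (x : Fin n → A) → BadSeq 1 x → ∀ {i j} → ¬ Step x i j
  bad₁-pair x bad {i} {j} s = bad (pair , λ { fz → s })
    where
    pair : Fin 2 → Fin _
    pair fz = i
    pair (fs _) = j

module _ {A : Set} where

  left : (xs ys : List A) → Fin (length xs) → Fin (length (xs ++ ys))
  left (_ ∷ _) ys fz = fz
  left (_ ∷ xs) ys (fs i) = fs (left xs ys i)

  right : (xs ys : List A) → Fin (length ys) → Fin (length (xs ++ ys))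
  right [] ys j = j
  right (_ ∷ xs) ys j = fs (right xs ys j)

  lookup-left : (xs ys : List A) (i : Fin (length xs)) → lookup (xs ++ ys) (left xs ys i) ≡ lookup xs i
  lookup-left (_ ∷ _) ys fz = refl
  lookup-left (_ ∷ xs) ys (fs i) = lookup-left xs ys i

  lookup-right : (xs ys : List A) (j : Fin (length ys)) → lookup (xs ++ ys) (right xs ys j) ≡ lookup ys j
  lookup-right [] ys j = refl
  lookup-right (_ ∷ xs) ys j = lookup-right xs ys j

  split : (xs ys : List A) → Fin (length (xs ++ ys)) → Fin (length xs) ⊎ Fin (length ys)
  split [] ys k = inj₂ k
  split (_ ∷ _) ys fz = inj₁ fz
  split (_ ∷ xs) ys (fs k) = Sum.map₁ fs (split xs ys k)

  split-left : (xs ys : List A) (i : Fin (length xs)) → split xs ys (left xs ys i) ≡ inj₁ i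
  split-left (_ ∷ _) ys fz = refl
  split-left (_ ∷ xs) ys (fs i) rewrite split-left xs ys i = refl

  split-right : (xs ys : List A) (j : Fin (length ys)) → split xs ys (right xs ys j) ≡ inj₂ j
  split-right [] ys j = refl
  split-right (_ ∷ xs) ys j rewrite split-right xs ys j = refl

  join-split : (xs ys : List A) (k : Fin (length (xs ++ ys))) →
    [ left xs ys , right xs ys ]′ (split xs ys k) ≡ k
  join-split [] ys k = refl
  join-split (_ ∷ _) ys fz = refl
  join-split (_ ∷ xs) ys (fs k) with split xs ys k | join-split xs ys k
  ... | inj₁ _ | e = cong fs e
  ... | inj₂ _ | e = cong fs e

  copyPos : ∀ r (a : A) → Fin r → Fin (length (replicate r a))
  copyPos (suc r) a fz = fz
  copyPos (suc r) a (fs c) = fs (copyPos r a c)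

  copyNum : ∀ r (a : A) → Fin (length (replicate r a)) → Fin r
  copyNum (suc r) a fz = fz
  copyNum (suc r) a (fs c) = fs (copyNum r a c)

  copyNum-copyPos : ∀ r (a : A) c → copyNum r a (copyPos r a c) ≡ c
  copyNum-copyPos (suc r) a fz = refl
  copyNum-copyPos (suc r) a (fs c) = cong fs (copyNum-copyPos r a c)

  copyPos-copyNum : ∀ r (a : A) c → copyPos r a (copyNum r a c) ≡ c
  copyPos-copyNum (suc r) a fz = refl
  copyPos-copyNum (suc r) a (fs c) = cong fs (copyPos-copyNum r a c)

  lookup-replicate : ∀ r (a : A) c → lookup (replicate r a) c ≡ a
  lookup-replicate (suc r) a fz = refl
  lookup-replicate (suc r) a (fs c) = lookup-replicate r a c

copy : ∀ r τ → Fin (length τ) → Fin r → Fin (length (r ×ᵀ τ))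
copy r (k ∷ τ) fz c = left (replicate r k) (r ×ᵀ τ) (copyPos r k c)
copy r (k ∷ τ) (fs i) c = right (replicate r k) (r ×ᵀ τ) (copy r τ i c)

uncopy : ∀ r τ → Fin (length (r ×ᵀ τ)) → Fin (length τ) × Fin r
uncopy r (k ∷ τ) m =
  [ (λ p → fz , copyNum r k p) , (λ m′ → Product.map₁ fs (uncopy r τ m′)) ]′
    (split (replicate r k) (r ×ᵀ τ) m)

copy-dim : ∀ r τ i c → lookup (r ×ᵀ τ) (copy r τ i c) ≡ lookup τ i
copy-dim r (k ∷ τ) fz c =
  trans (lookup-left (replicate r k) (r ×ᵀ τ) (copyPos r k c)) (lookup-replicate r k (copyPos r k c))
copy-dim r (k ∷ τ) (fs i) c =
  trans (lookup-right (replicate r k) (r ×ᵀ τ) (copy r τ i c)) (copy-dim r τ i c)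

uncopy-copy : ∀ r τ i c → uncopy r τ (copy r τ i c) ≡ (i , c)
uncopy-copy r (k ∷ τ) fz c
  rewrite split-left (replicate r k) (r ×ᵀ τ) (copyPos r k c) = cong (fz ,_) (copyNum-copyPos r k c)
uncopy-copy r (k ∷ τ) (fs i) c
  rewrite split-right (replicate r k) (r ×ᵀ τ) (copy r τ i c) | uncopy-copy r τ i c = refl

copy-uncopy : ∀ r τ m → uncurry (copy r τ) (uncopy r τ m) ≡ m
copy-uncopy r (k ∷ τ) m
  with split (replicate r k) (r ×ᵀ τ) m | join-split (replicate r k) (r ×ᵀ τ) m
... | inj₁ p | e = trans (cong (left (replicate r k) (r ×ᵀ τ)) (copyPos-copyNum r k p)) e
... | inj₂ m′ | e = trans (cong (right (replicate r k) (r ×ᵀ τ)) (copy-uncopy r τ m′)) e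

-- x ≼ y compares summands by equality and tuples pointwise; the tuples may
-- have propositionally (not definitionally) equal lengths.
≼⇔ : ∀ {τ} (x y : Elem τ) →
  _≼_ {τ} x y ⇔ (proj₁ x ≡ proj₁ y × Pointwise _≤_ (proj₂ x) (proj₂ y))
≼⇔ _ _ = mk⇔ (λ { (same le) → refl , le }) (λ { (refl , le) → same le })

≼-dec : ∀ {τ} (x y : Elem τ) → Dec (_≼_ {τ} x y)
≼-dec {τ} x@(i , u) y@(j , v) =
  map′ (from (≼⇔ x y)) (to (≼⇔ x y)) (i ≟F j ×-dec Pointwise.decidable _≤?_ u v)

≼-trans : ∀ {τ} {x y z : Elem τ} → _≼_ {τ} x y → _≼_ {τ} y z → _≼_ {τ} x z
≼-trans (same le₁) (same le₂) = same (Pointwise.trans ≤-trans le₁ le₂)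

norm-subst : ∀ {a b} (e : a ≡ b) (v : Vec ℕ a) →
  foldr (λ _ → ℕ) _⊔_ 0 (subst (Vec ℕ) e v) ≡ foldr (λ _ → ℕ) _⊔_ 0 v
norm-subst refl v = refl

Pointwise-subst : ∀ {a b c d} (e : a ≡ b) (e′ : c ≡ d) {u : Vec ℕ a} {v : Vec ℕ c} →
  Pointwise _≤_ (subst (Vec ℕ) e u) (subst (Vec ℕ) e′ v) ⇔ Pointwise _≤_ u v
Pointwise-subst refl refl = mk⇔ id id

moveTo : ∀ {τ} σ (x : Elem τ) (j : Fin (length σ)) → lookup σ j ≡ lookup τ (proj₁ x) → Elem σ
moveTo σ (i , v) j e = j , subst (Vec ℕ) (sym e) v

norm-moveTo : ∀ {τ} σ (x : Elem τ) j e → norm σ (moveTo {τ} σ x j e) ≡ norm τ x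
norm-moveTo σ (i , v) j e = norm-subst (sym e) v

moveTo-≼ : ∀ {τ} σ (x y : Elem τ) j j′ e e′ →
  _≼_ {σ} (moveTo {τ} σ x j e) (moveTo {τ} σ y j′ e′) ⇔ (j ≡ j′ × Pointwise _≤_ (proj₂ x) (proj₂ y))
moveTo-≼ {τ} σ x@(_ , u) y@(_ , v) j j′ e e′ = mk⇔
  (λ le → Product.map₂ (to (Pointwise-subst (sym e) (sym e′)))
                       (to (≼⇔ {σ} (moveTo {τ} σ x j e) (moveTo {τ} σ y j′ e′)) le))
  (λ { (refl , le) → same (from (Pointwise-subst (sym e) (sym e′)) le) })

module Copies (r : ℕ) (τ : Ty) where

  inCopy : Fin r → Elem τ → Elem (r ×ᵀ τ)
  inCopy c x = moveTo {τ} (r ×ᵀ τ) x (copy r τ (proj₁ x) c) (copy-dim r τ (proj₁ x) c)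

  colour : Elem (r ×ᵀ τ) → Fin r
  colour y = proj₂ (uncopy r τ (proj₁ y))

  uncopy-dim : ∀ m → lookup τ (proj₁ (uncopy r τ m)) ≡ lookup (r ×ᵀ τ) m
  uncopy-dim m = trans (sym (copy-dim r τ _ _)) (cong (lookup (r ×ᵀ τ)) (copy-uncopy r τ m))

  underlying : Elem (r ×ᵀ τ) → Elem τ
  underlying y = moveTo {r ×ᵀ τ} τ y (proj₁ (uncopy r τ (proj₁ y))) (uncopy-dim (proj₁ y))

  inCopy-≼ : ∀ c d (x y : Elem τ) → _≼_ {r ×ᵀ τ} (inCopy c x) (inCopy d y) → c ≡ d × _≼_ {τ} x y
  inCopy-≼ c d x y le
    with to (moveTo-≼ {τ} (r ×ᵀ τ) x y _ _ (copy-dim r τ (proj₁ x) c) (copy-dim r τ (proj₁ y) d)) le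
  ... | same-summand , tuples≤ =
    cong proj₂ same-pair , from (≼⇔ {τ} x y) (cong proj₁ same-pair , tuples≤)
    where
    same-pair : (proj₁ x , c) ≡ (proj₁ y , d)
    same-pair = trans (sym (uncopy-copy r τ (proj₁ x) c))
                      (trans (cong (uncopy r τ) same-summand) (uncopy-copy r τ (proj₁ y) d))

  underlying-≼ : ∀ (y y′ : Elem (r ×ᵀ τ)) → colour y ≡ colour y′ →
    _≼_ {τ} (underlying y) (underlying y′) → _≼_ {r ×ᵀ τ} y y′
  underlying-≼ y y′ same-colour le
    with to (moveTo-≼ {r ×ᵀ τ} τ y y′ _ _ (uncopy-dim (proj₁ y)) (uncopy-dim (proj₁ y′))) le
  ... | same-origin , tuples≤ = from (≼⇔ {r ×ᵀ τ} y y′) (same-summand , tuples≤)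
    where
    same-summand : proj₁ y ≡ proj₁ y′
    same-summand = trans (sym (copy-uncopy r τ (proj₁ y)))
      (trans (cong (uncurry (copy r τ)) (cong₂ _,_ same-origin same-colour)) (copy-uncopy r τ (proj₁ y′)))

  open Sequences

  toCopies : ∀ f t n → HasBad f r τ t n → HasBad f 1 (r ×ᵀ τ) t n
  toCopies f t n (x , controlled , bad) = y , controlledʸ , bad₁ (_≼_ {r ×ᵀ τ}) y no-pair
    where
    splitting : Splitting (_≼_ {τ}) r x
    splitting = bad⇒splitting (_≼_ {τ}) ≼-dec r x bad

    y : Seq (r ×ᵀ τ) n
    y j = inCopy (proj₁ splitting j) (x j)

    controlledʸ : Controlled f t {r ×ᵀ τ} y
    controlledʸ j = subst (_< f (toℕ j + t))
      (sym (norm-moveTo {τ} (r ×ᵀ τ) (x j) _ (copy-dim r τ (proj₁ (x j)) (proj₁ splitting j))))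
      (controlled j)

    no-pair : ∀ {i j} → ¬ Step (_≼_ {r ×ᵀ τ}) y i j
    no-pair {i} {j} (lt , le) with inCopy-≼ _ _ (x i) (x j) le
    ... | same-colour , le′ = proj₂ splitting (lt , le′) same-colour

  fromCopies : ∀ f t n → HasBad f 1 (r ×ᵀ τ) t n → HasBad f r τ t n
  fromCopies f t n (y , controlled , bad) =
    x , controlledˣ , splitting⇒bad (_≼_ {τ}) ≼-trans r x ((λ j → colour (y j)) , bichromatic)
    where
    x : Seq τ n
    x j = underlying (y j)

    controlledˣ : Controlled f t {τ} x
    controlledˣ j = subst (_< f (toℕ j + t))
      (sym (norm-moveTo {r ×ᵀ τ} τ (y j) _ (uncopy-dim (proj₁ (y j)))))
      (controlled j)

    bichromatic : ∀ {i j} → Step (_≼_ {τ}) x i j → colour (y i) ≢ colour (y j)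
    bichromatic {i} {j} (lt , le) same-colour =
      bad₁-pair (_≼_ {r ×ᵀ τ}) y bad (lt , underlying-≼ (y i) (y j) same-colour le)

IsMax-cong : ∀ {P Q : ℕ → Set} → (∀ n → P n ⇔ Q n) → ∀ m → IsMax P m ⇔ IsMax Q m
IsMax-cong P⇔Q m = mk⇔
  (λ (p , maximal) → to (P⇔Q m) p , λ n q → maximal n (from (P⇔Q n) q))
  (λ (q , maximal) → from (P⇔Q m) q , λ n p → maximal n (to (P⇔Q n) p))

mainTheorem2 : (f : ℕ → ℕ) → Monotone f → 0 < f 0 →
    (τ : Ty) (r : ℕ) → 1 ≤ r → (t : ℕ) →
    ∀ (m : ℕ) → IsL f r τ t m ⇔ IsL f 1 (r ×ᵀ τ) t m
mainTheorem2 f _ _ τ r _ t =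
  IsMax-cong (λ n → mk⇔ (toCopies f t n) (fromCopies f t n))
  where open Copies r τ
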